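{- In the formal system $\mathbf{LA}\mu$ the following rule is derivable: if $\Gamma\vdash\bullet A\to A$ is derivable, then $\Gamma\vdash A$ is derivable. (Equivalently, $\vdash(\bullet A\to A)\to A$ is derivable for every formula $A$.)
   Context: Formulae are type expressions: pseudo type expressions $A::=X\mid A\to B\mid\bullet A\mid\mu X.A$ (propositional variables $X$; $\alpha$-equivalent ones identified; $A[B/X]$ capture-avoiding substitution) in which every subexpression $\mu X.A$ has $A$ proper in $X$. Here $t(X)=X$, $t(A\to B)=t(B)$, $t(\bullet A)=\bullet t(A)$, $t(\mu X.A)=\mu X.t(A)$; $A$ is a $\top$-variant iff $t(A)=\bullet^{m_0}\mu X_1.\bullet^{m_1}\cdots\mu X_n.\bullet^{m_n}X_i$ with $1\le i\le n$, $X_i\notin\{X_{i+1},\dots,X_n\}$, $m_i+\dots+m_n\ge1$; properness in $X$: variable $Y$ iff $Y\ne X$; $\bullet A$ always; $A\to B$ iff both are or $B$ is a $\top$-variant; $\mu Y.A$ ($Y\neq X$) iff $A$ is or $\mu Y.A$ is a $\top$-variant. $\mathbf{LA}\mu$ derives judgments $\Gamma\vdash A$ ($\Gamma$ a finite set of formulae, $\bullet\Gamma=\{\bullet B\mid B\in\Gamma\}$) by the rules: $\Gamma\cup\{A\}\vdash A$; from $\Gamma_1\vdash A$ infer $\bullet\Gamma_1\cup\Gamma_2\vdash\bullet A$; from $\Gamma\vdash\bullet A$ infer $\Gamma\vdash\bullet\bullet A$; from $\Gamma\cup\{A\}\vdash B$ infer $\Gamma\vdash A\to B$; from $\Gamma_1\vdash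 A\to B$ and $\Gamma_2\vdash A$ infer $\Gamma_1\cup\Gamma_2\vdash B$; from $\Gamma\vdash A[\mu X.A/X]$ infer $\Gamma\vdash\mu X.A$ and conversely; from $\Gamma\vdash\bullet A\to\bullet B$ infer $\Gamma\vdash\bullet(A\to B)$; from $\Gamma\vdash A$ infer $\Gamma\vdash\bullet A$. -}

module Defs where

open import Data.Nat using (ℕ; zero; suc)
open import Data.Bool using (Bool; true; false; T)
open import Data.List using (List; []; _∷_; map; _++_)
open import Data.List.Membership.Propositional using (_∈_)
open import Data.List.Relation.Unary.All using (All)
open import Data.Product using (_×_)
open import Data.Sum using (_⊎_)
open import Data.Unit using (⊤)
open import Data.Empty using (⊥)
open import Relation.Binary.PropositionalEquality using (_≡_)
open import Relation.Nullary using (¬_)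
open import Function.Bundles using (_⇔_)

infixr 20 _⇒_
infix 25 ●_
infix 4 _⊢_ _≋_

-- Pseudo type expressions, with de Bruijn indices (so α-equivalent
-- expressions are literally identified).  `μ A` binds index 0 in A.

data Ty : Set where
  `_  : ℕ → Ty
  _⇒_ : Ty → Ty → Ty
  ●_  : Ty → Ty
  μ_  : Ty → Ty

ext : (ℕ → ℕ) → ℕ → ℕ
ext ρ zero    = zero
ext ρ (suc n) = suc (ρ n)

rename : (ℕ → ℕ) → Ty → Ty
rename ρ (` n)   = ` ρ n
rename ρ (A ⇒ B) = rename ρ A ⇒ rename ρ B
rename ρ (● A)   = ● rename ρ A
rename ρ (μ A)   = μ rename (ext ρ) A

exts : (ℕ → Ty) → ℕ → Ty
exts σ zero    = ` zero
exts σ (suc n) = rename suc (σ n)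

subst : (ℕ → Ty) → Ty → Ty
subst σ (` n)   = σ n
subst σ (A ⇒ B) = subst σ A ⇒ subst σ B
subst σ (● A)   = ● subst σ A
subst σ (μ A)   = μ subst (exts σ) A

σ₀ : Ty → ℕ → Ty
σ₀ B zero    = B
σ₀ B (suc n) = ` n

_[_]₀ : Ty → Ty → Ty
A [ B ]₀ = subst (σ₀ B) A

t : Ty → Ty
t (` n)   = ` n
t (A ⇒ B) = t B
t (● A)   = ● t A
t (μ A)   = μ t A

-- We scan t(A) = ●^{m0} μX1.●^{m1} ... μXn.●^{mn} X_i from the
-- outside, keeping for each binder seen so far (innermost first) a flag
-- recording whether some ● has occurred after it.  The final variable
-- must be bound by one of these binders (de Bruijn: this is exactly
-- "X_i with 1 ≤ i ≤ n, X_i ∉ {X_{i+1},…,X_n}") whose flag is set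
-- (i.e. m_i + … + m_n ≥ 1).
marked : List Bool → ℕ → Set
marked []      _       = ⊥
marked (b ∷ _) zero    = T b
marked (_ ∷ e) (suc k) = marked e k

setAll : List Bool → List Bool
setAll []      = []
setAll (_ ∷ e) = true ∷ setAll e

TopChain : List Bool → Ty → Set
TopChain e (` k)   = marked e k
TopChain e (_ ⇒ _) = ⊥
TopChain e (● A)   = TopChain (setAll e) A
TopChain e (μ A)   = TopChain (false ∷ e) A

TopVariant : Ty → Set
TopVariant A = TopChain [] (t A)

Proper : ℕ → Ty → Set
Proper x (` y)   = ¬ (y ≡ x)
Proper x (● A)   = ⊤
Proper x (A ⇒ B) = (Proper x A × Proper x B) ⊎ TopVariant B
Proper x (μ A)   = Proper (suc x) A ⊎ TopVariant (μ A)

Formula : Ty → Set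
Formula (` n)   = ⊤
Formula (A ⇒ B) = Formula A × Formula B
Formula (● A)   = Formula A
Formula (μ A)   = Proper zero A × Formula A

-- Contexts: finite sets of formulae, represented by lists; Γ ≋ Δ means
-- they denote the same set.  Unions are represented by _++_ up to ≋.

Ctx : Set
Ctx = List Ty

_≋_ : Ctx → Ctx → Set
Γ ≋ Δ = ∀ C → (C ∈ Γ) ⇔ (C ∈ Δ)

●ctx : Ctx → Ctx
●ctx = map ●_

-- Judgment Γ ⊢ A of LAμ.  Every rule additionally requires that its
-- conclusion consists of formulae (so all judgments in a derivation
-- are about formulae, not mere pseudo type expressions).
data _⊢_ : Ctx → Ty → Set where
  ax    : ∀ {Γ A} → All Formula Γ → Formula A →
          A ∈ Γ → Γ ⊢ A
  ●I    : ∀ {Γ₁ Γ₂ Δ A} → All Formula Δ → Formula (● A) →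
          Γ₁ ⊢ A → Δ ≋ (●ctx Γ₁ ++ Γ₂) → Δ ⊢ ● A
  ●●    : ∀ {Γ A} → All Formula Γ → Formula (● ● A) →
          Γ ⊢ ● A → Γ ⊢ ● ● A
  ⇒I    : ∀ {Γ Γ' A B} → All Formula Γ → Formula (A ⇒ B) →
          Γ' ⊢ B → Γ' ≋ (A ∷ Γ) → Γ ⊢ A ⇒ B
  ⇒E    : ∀ {Γ₁ Γ₂ Δ A B} → All Formula Δ → Formula B →
          Γ₁ ⊢ A ⇒ B → Γ₂ ⊢ A → Δ ≋ (Γ₁ ++ Γ₂) → Δ ⊢ B
  μI    : ∀ {Γ A} → All Formula Γ → Formula (μ A) →
          Γ ⊢ A [ μ A ]₀ → Γ ⊢ μ A
  μE    : ∀ {Γ A} → All Formula Γ → Formula (A [ μ A ]₀) →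
          Γ ⊢ μ A → Γ ⊢ A [ μ A ]₀
  ●⇒    : ∀ {Γ A B} → All Formula Γ → Formula (● (A ⇒ B)) →
          Γ ⊢ ● A ⇒ ● B → Γ ⊢ ● (A ⇒ B)
  ●Nec  : ∀ {Γ A} → All Formula Γ → Formula (● A) →
          Γ ⊢ A → Γ ⊢ ● A

module Submission where

-- The proof is Löb's fixed-point argument, available internally because
-- μ-types unfold.  Put B = μX.(●X → A) with X fresh for A, so that B
-- unfolds to ●B → A.
--   * From the hypothesis B we get ●B → A (unfold) and ●B (necessitation),
--     hence  B ⊢ A.
--   * By ●-introduction  ●B, Γ ⊢ ●A;  with Γ ⊢ ●A → A this gives ●B, Γ ⊢ A,
--     i.e.  Γ ⊢ ●B → A,  which folds to  Γ ⊢ B.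
--   * Necessitation gives Γ ⊢ ●B, and modus ponens with Γ ⊢ ●B → A gives A.

open import Defs
open import Data.Nat using (ℕ; zero; suc; _<_; z<s; s<s; s<s⁻¹)
open import Data.Nat.Properties using (suc-injective)
open import Data.Bool using (false)
open import Data.List using ([]; _∷_; _++_; length)
open import Data.List.Relation.Unary.All using (All; []; _∷_)
open import Data.List.Relation.Unary.Any using (here; there)
open import Data.List.Membership.Propositional using (_∈_)
open import Data.List.Membership.Propositional.Properties using (∈-++⁻; ∈-++⁺ʳ)
open import Data.Unit using (tt)
open import Data.Product using (_,_)
open import Data.Sum using (inj₁; inj₂; [_,_]′)
open import Function using (_∘_; id)
open import Function.Bundles using (mk⇔)
open import Function.Definitions using (Injective)
open import Relation.Binary.PropositionalEquality
  using (_≡_; _≢_; refl; cong; cong₂; sym; trans)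
  renaming (subst to transport)
open import Relation.Binary.PropositionalEquality.Properties using (module ≡-Reasoning)

InjectiveRenaming : (ℕ → ℕ) → Set
InjectiveRenaming ρ = Injective _≡_ _≡_ ρ

ext-injective : ∀ ρ → InjectiveRenaming ρ → InjectiveRenaming (ext ρ)
ext-injective ρ inj {zero}  {zero}  eq = refl
ext-injective ρ inj {suc a} {suc b} eq = cong suc (inj (suc-injective eq))

t-rename : ∀ ρ A → t (rename ρ A) ≡ rename ρ (t A)
t-rename ρ (` n)   = refl
t-rename ρ (A ⇒ B) = t-rename ρ B
t-rename ρ (● A)   = cong ●_ (t-rename ρ A)
t-rename ρ (μ A)   = cong μ_ (t-rename (ext ρ) A)

marked-bound : ∀ e k → marked e k → k < length e
marked-bound (b ∷ e) zero    m = z<s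
marked-bound (b ∷ e) (suc k) m = s<s (marked-bound e k m)

length-setAll : ∀ e → length (setAll e) ≡ length e
length-setAll []      = refl
length-setAll (b ∷ e) = cong suc (length-setAll e)

topChain-rename : ∀ e A ρ → (∀ k → k < length e → ρ k ≡ k) →
                  TopChain e A → TopChain e (rename ρ A)
topChain-rename e (` k) ρ fixes m =
  transport (marked e) (sym (fixes k (marked-bound e k m))) m
topChain-rename e (● A) ρ fixes c =
  topChain-rename (setAll e) A ρ
    (λ k k<e → fixes k (transport (k <_) (length-setAll e) k<e)) c
topChain-rename e (μ A) ρ fixes c =
  topChain-rename (false ∷ e) A (ext ρ) ext-fixes c
  where
  ext-fixes : ∀ k → k < suc (length e) → ext ρ k ≡ k
  ext-fixes zero    _   = refl
  ext-fixes (suc k) k<e = cong suc (fixes k (s<s⁻¹ k<e))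

-- A ⊤-variant is closed in its result chain, so any renaming preserves it.
topVariant-rename : ∀ ρ A → TopVariant A → TopVariant (rename ρ A)
topVariant-rename ρ A tv rewrite t-rename ρ A =
  topChain-rename [] (t A) ρ (λ k ()) tv

proper-rename : ∀ ρ x A → InjectiveRenaming ρ →
                Proper x A → Proper (ρ x) (rename ρ A)
proper-rename ρ x (` y)   inj y≢x = y≢x ∘ inj
proper-rename ρ x (A ⇒ B) inj (inj₁ (pA , pB)) =
  inj₁ (proper-rename ρ x A inj pA , proper-rename ρ x B inj pB)
proper-rename ρ x (A ⇒ B) inj (inj₂ tv) = inj₂ (topVariant-rename ρ B tv)
proper-rename ρ x (● A)   inj p = tt
proper-rename ρ x (μ A)   inj (inj₁ p) =
  inj₁ (proper-rename (ext ρ) (suc x) A (ext-injective ρ inj) p)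
proper-rename ρ x (μ A)   inj (inj₂ tv) = inj₂ (topVariant-rename ρ (μ A) tv)

formula-rename : ∀ ρ A → InjectiveRenaming ρ → Formula A → Formula (rename ρ A)
formula-rename ρ (` n)   inj f = tt
formula-rename ρ (A ⇒ B) inj (fA , fB) =
  formula-rename ρ A inj fA , formula-rename ρ B inj fB
formula-rename ρ (● A)   inj f = formula-rename ρ A inj f
formula-rename ρ (μ A)   inj (p , f) =
  proper-rename (ext ρ) zero A (ext-injective ρ inj) p ,
  formula-rename (ext ρ) A (ext-injective ρ inj) f

-- Every type is proper in a variable that a renaming misses: the variable
-- does not occur at all.
proper-fresh : ∀ ρ x A → (∀ n → ρ n ≢ x) → Proper x (rename ρ A)
proper-fresh ρ x (` y)   fresh = fresh y
proper-fresh ρ x (A ⇒ B) fresh =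
  inj₁ (proper-fresh ρ x A fresh , proper-fresh ρ x B fresh)
proper-fresh ρ x (● A)   fresh = tt
proper-fresh ρ x (μ A)   fresh = inj₁ (proper-fresh (ext ρ) (suc x) A ext-fresh)
  where
  ext-fresh : ∀ n → ext ρ n ≢ suc x
  ext-fresh (suc n) eq = fresh n (suc-injective eq)

subst-cong : ∀ σ τ A → (∀ n → σ n ≡ τ n) → subst σ A ≡ subst τ A
subst-cong σ τ (` n)   eq = eq n
subst-cong σ τ (A ⇒ B) eq = cong₂ _⇒_ (subst-cong σ τ A eq) (subst-cong σ τ B eq)
subst-cong σ τ (● A)   eq = cong ●_ (subst-cong σ τ A eq)
subst-cong σ τ (μ A)   eq = cong μ_ (subst-cong (exts σ) (exts τ) A exts-eq)
  where
  exts-eq : ∀ n → exts σ n ≡ exts τ n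
  exts-eq zero    = refl
  exts-eq (suc n) = cong (rename suc) (eq n)

subst-rename : ∀ σ ρ A → subst σ (rename ρ A) ≡ subst (σ ∘ ρ) A
subst-rename σ ρ (` n)   = refl
subst-rename σ ρ (A ⇒ B) = cong₂ _⇒_ (subst-rename σ ρ A) (subst-rename σ ρ B)
subst-rename σ ρ (● A)   = cong ●_ (subst-rename σ ρ A)
subst-rename σ ρ (μ A)   = cong μ_ (trans (subst-rename (exts σ) (ext ρ) A)
                                          (subst-cong _ _ A exts-ext))
  where
  exts-ext : ∀ n → exts σ (ext ρ n) ≡ exts (σ ∘ ρ) n
  exts-ext zero    = refl
  exts-ext (suc n) = refl

subst-id : ∀ σ A → (∀ n → σ n ≡ ` n) → subst σ A ≡ A
subst-id σ (` n)   eq = eq n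
subst-id σ (A ⇒ B) eq = cong₂ _⇒_ (subst-id σ A eq) (subst-id σ B eq)
subst-id σ (● A)   eq = cong ●_ (subst-id σ A eq)
subst-id σ (μ A)   eq = cong μ_ (subst-id (exts σ) A exts-id)
  where
  exts-id : ∀ n → exts σ n ≡ ` n
  exts-id zero    = refl
  exts-id (suc n) = cong (rename suc) (eq n)

shift-subst₀ : ∀ A B → rename suc A [ B ]₀ ≡ A
shift-subst₀ A B = begin
  subst (σ₀ B) (rename suc A) ≡⟨ subst-rename (σ₀ B) suc A ⟩
  subst (σ₀ B ∘ suc) A        ≡⟨ subst-id (σ₀ B ∘ suc) A (λ n → refl) ⟩
  A                           ∎
  where open ≡-Reasoning

≋-refl : ∀ Γ → Γ ≋ Γ
≋-refl Γ C = mk⇔ id id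

-- Modus ponens where the premises' contexts are contained in the
-- conclusion's: Δ is then equal, as a set, to Γ ∪ Δ.
⇒E-into : ∀ {Γ Δ A B} → All Formula Δ → Formula B →
          Γ ⊢ A ⇒ B → Δ ⊢ A → (∀ {C} → C ∈ Γ → C ∈ Δ) → Δ ⊢ B
⇒E-into {Γ} {Δ} fΔ fB dAB dA Γ⊆Δ = ⇒E fΔ fB dAB dA Δ≋Γ++Δ
  where
  Δ≋Γ++Δ : Δ ≋ Γ ++ Δ
  Δ≋Γ++Δ C = mk⇔ (∈-++⁺ʳ Γ) ([ Γ⊆Δ , id ]′ ∘ ∈-++⁻ Γ)

⇒E-same : ∀ {Δ A B} → All Formula Δ → Formula B →
          Δ ⊢ A ⇒ B → Δ ⊢ A → Δ ⊢ B
⇒E-same fΔ fB dAB dA = ⇒E-into fΔ fB dAB dA id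

module LöbFixedPoint (A : Ty) (fA : Formula A) where

  -- The body ●X → A, with A shifted past the new binder X = index 0.
  body : Ty
  body = ● (` 0) ⇒ rename suc A

  B : Ty
  B = μ body

  -- B is a formula: the bound variable sits under ●, and A is shifted.
  formula-B : Formula B
  formula-B = inj₁ (tt , proper-fresh suc zero A (λ n ())) ,
              (tt , formula-rename suc A suc-injective fA)

  body-unfolds : body [ B ]₀ ≡ ● B ⇒ A
  body-unfolds = cong (● B ⇒_) (shift-subst₀ A B)

  unfold : ∀ {Δ} → All Formula Δ → Δ ⊢ B → Δ ⊢ ● B ⇒ A
  unfold {Δ} fΔ d = transport (Δ ⊢_) body-unfolds
    (μE fΔ (transport Formula (sym body-unfolds) (formula-B , fA)) d)

  fold : ∀ {Δ} → All Formula Δ → Δ ⊢ ● B ⇒ A → Δ ⊢ B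
  fold {Δ} fΔ d = μI fΔ formula-B (transport (Δ ⊢_) (sym body-unfolds) d)

  self-application : B ∷ [] ⊢ A
  self-application = ⇒E-same fB fA (unfold fB hyp) (●Nec fB formula-B hyp)
    where
    fB : All Formula (B ∷ [])
    fB = formula-B ∷ []
    hyp : B ∷ [] ⊢ B
    hyp = ax fB formula-B (here refl)

proposition10p3 : ∀ (Γ : Ctx) (A : Ty) → All Formula Γ → Formula A →
                    Γ ⊢ ● A ⇒ A → Γ ⊢ A
proposition10p3 Γ A fΓ fA löb-hyp = ⇒E-same fΓ fA ●B⇒A (●Nec fΓ formula-B ⊢B)
  where
  open LöbFixedPoint A fA
  f●BΓ : All Formula (● B ∷ Γ)
  f●BΓ = formula-B ∷ fΓ
  ●B,Γ⊢●A : ● B ∷ Γ ⊢ ● A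
  ●B,Γ⊢●A = ●I f●BΓ fA self-application (≋-refl _)
  ●B⇒A : Γ ⊢ ● B ⇒ A
  ●B⇒A = ⇒I fΓ (formula-B , fA) (⇒E-into f●BΓ fA löb-hyp ●B,Γ⊢●A there)
            (≋-refl _)
  ⊢B : Γ ⊢ B
  ⊢B = fold fΓ ●B⇒A
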